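{- Let $\tau$ be a finite rooted tree and $v\in\mathcal{V}(\tau)$. Let $C\subset\mathcal{C}_\tau(v)$, and let $\theta$ be the tree obtained from $\tau$ by adding a new vertex $w$ as a child of $v$ and making the vertices of $C$ children of $w$ (instead of $v$). Let $M_{\tau\to\theta}$ be the mapping sending each vertex of $\tau$ to itself in $\theta$. Then $M_{\tau\to\theta}$ is a constrained mapping in the sense of Zhang if and only if $C=\emptyset$, $\#C=1$, or $\#C=\#\mathcal{C}_\tau(v)$.
   Context: $\mathcal{C}_\tau(v)$ denotes the set of children of $v$ in $\tau$. A mapping between trees $\tau$ and $\theta$ is a one-to-one correspondence $\varphi$ from a subset of $\mathcal{V}(\tau)$ onto a subset of $\mathcal{V}(\theta)$ preserving the ancestor order (for $v,v'$ in its domain, $v$ is an ancestor of $v'$ iff $\varphi(v)$ is an ancestor of $\varphi(v')$). It is a constrained mapping (in the sense of Zhang) if moreover, for all $v_1,v_2,v_3$ in its domain with $w_i=\varphi(v_i)$, the least common ancestor $\mathrm{LCA}(v_1,v_2)$ is a proper ancestor of $v_3$ in $\tau$ if and only if $\mathrm{LCA}(w_1,w_2)$ is a proper ancestor of $w_3$ in $\theta$. -}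

module Defs where

open import Data.Nat using (ℕ; suc)
import Data.Nat as ℕ
import Data.Fin as Fin
open import Data.Fin using (Fin; fromℕ; inject₁)
open import Data.Fin.Properties using (_≟_)
open import Data.Fin.Subset using (Subset; _∈_; ∣_∣)
open import Data.Maybe using (Maybe; just; nothing)
import Data.Maybe as Maybe
open import Data.Maybe.Properties using (≡-dec)
open import Data.Vec using (tabulate; lookup)
open import Data.Bool using (if_then_else_)
open import Data.Product using (Σ; _×_; ∃)
open import Function.Bundles using (_⇔_)
open import Relation.Nullary using (¬_; does)
open import Relation.Binary.PropositionalEquality using (_≡_)

-- A (labelled) forest-structure on the vertex set Fin n, given by a parent
-- function: parent v ≡ nothing means v has no parent (is a root).
Parent : ℕ → Set
Parent n = Fin n → Maybe (Fin n)

data Anc {n : ℕ} (p : Parent n) (u : Fin n) : Fin n → Set where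
  here : Anc p u u
  step : ∀ {v w} → p v ≡ just w → Anc p u w → Anc p u v

data PAnc {n : ℕ} (p : Parent n) (u : Fin n) : Fin n → Set where
  step : ∀ {v w} → p v ≡ just w → Anc p u w → PAnc p u v

record IsRootedTree {n : ℕ} (p : Parent n) : Set where
  field
    acyclic : ∀ v → ¬ PAnc p v v
    root    : Fin n
    rootAnc : ∀ v → Anc p root v

IsLCA : ∀ {n} → Parent n → Fin n → Fin n → Fin n → Set
IsLCA p a b c = Anc p c a × Anc p c b × (∀ d → Anc p d a → Anc p d b → Anc p d c)

-- A mapping given as a partial function φ (φ v ≡ nothing: v ∉ domain).
-- It is one-to-one on its domain and preserves the ancestor order.
IsMapping : ∀ {n m} → Parent n → Parent m → (Fin n → Maybe (Fin m)) → Set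
IsMapping {n} {m} p q φ =
  (∀ v v' w w' → φ v ≡ just w → φ v' ≡ just w' →
     (w ≡ w' → v ≡ v') × (Anc p v v' ⇔ Anc q w w'))

IsConstrainedMapping : ∀ {n m} → Parent n → Parent m → (Fin n → Maybe (Fin m)) → Set
IsConstrainedMapping {n} {m} p q φ =
  IsMapping p q φ ×
  (∀ v₁ v₂ v₃ w₁ w₂ w₃ → φ v₁ ≡ just w₁ → φ v₂ ≡ just w₂ → φ v₃ ≡ just w₃ →
     ∀ c c' → IsLCA p v₁ v₂ c → IsLCA q w₁ w₂ c' →
     (PAnc p c v₃ ⇔ PAnc q c' w₃))

children : ∀ {n} → Parent n → Fin n → Subset n
children p v = tabulate (λ u → does (≡-dec _≟_ (p u) (just v)))

-- θ: add a new vertex w = fromℕ n (the last element of Fin (suc n)) as a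
-- child of v, and make the vertices of C children of w instead of v.
-- Old vertices u are embedded as inject₁ u.
-- Decode a vertex of Fin (suc n): nothing for the new last vertex fromℕ n,
-- just u for inject₁ u.
old? : ∀ n → Fin (suc n) → Maybe (Fin n)
old? ℕ.zero    Fin.zero    = nothing
old? (ℕ.suc n) Fin.zero    = just Fin.zero
old? (ℕ.suc n) (Fin.suc x) = Maybe.map Fin.suc (old? n x)

insertNode : ∀ {n} → Parent n → Fin n → Subset n → Parent (suc n)
insertNode {n} p v C x with old? n x
... | nothing = just (inject₁ v)
... | just u  = if lookup C u then just (fromℕ n) else Maybe.map inject₁ (p u)

embedMap : ∀ {n} → Fin n → Maybe (Fin (suc n))
embedMap u = just (inject₁ u)

-- Old vertices embed into θ with the same ancestor order, and contracting the edge from w to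
-- v maps θ's ancestor order back onto τ's. So least common ancestors agree in τ and θ except
-- for two vertices lying below two distinct members of C: their LCA is v in τ but w in θ.
-- For such a pair the constraint asks that the proper descendants of v and of w coincide,
-- i.e. that every child of v lies in C. Conversely, two members of C together with a child
-- of v outside C form a triple violating the constraint.
module Submission where

open import Defs
open import Data.Nat using (ℕ; suc)
open import Data.Fin using (Fin)
open import Data.Fin.Subset using (Subset; _∈_; _⊆_; ∣_∣; ⊥)
open import Data.Sum using (_⊎_)
open import Data.Maybe using (just)
open import Function.Bundles using (_⇔_)
open import Relation.Binary.PropositionalEquality using (_≡_)

open import Data.Nat using (zero; _<_)
open import Data.Nat.Properties using (<-irrefl; >⇒≢)
open import Data.Fin using (fromℕ; inject₁; _≟_)
import Data.Fin as Fin
open import Data.Fin.Properties using (fromℕ≢inject₁; inject₁-injective; any?)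
open import Data.Fin.Subset using (_∉_; ⁅_⁆)
open import Data.Fin.Subset.Properties
  using (_∈?_; nonempty?; Empty-unique; ⊆-antisym; ∉⊥; x∈⁅x⁆; x∈⁅y⁆⇒x≡y; x≢y⇒x∉⁅y⁆; ∣⁅x⁆∣≡1; p⊂q⇒∣p∣<∣q∣)
open import Data.Maybe using (nothing; maybe′)
import Data.Maybe as Maybe
open import Data.Maybe.Properties using (just-injective; ≡-dec)
open import Data.Vec using (lookup)
open import Data.Vec.Properties using ([]=⇒lookup; lookup⇒[]=; lookup∘tabulate)
open import Data.Bool using (Bool; true; false; if_then_else_)
open import Data.Product using (_×_; _,_; ∃; ∃₂)
open import Data.Sum using (inj₁; inj₂)
open import Function using (id; _∘_)
open import Function.Bundles using (mk⇔; Equivalence)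
open import Relation.Nullary using (¬_; yes; no; does; contradiction)
open import Relation.Nullary.Decidable using (_×-dec_; ¬?; dec-true; decidable-stable)
open import Relation.Binary.PropositionalEquality using (_≢_; refl; sym; trans; cong; subst; subst₂)

open Equivalence using (to; from)

module _ {n : ℕ} {p : Parent n} where

  anc-trans : ∀ {a b c} → Anc p a b → Anc p b c → Anc p a c
  anc-trans a≼b here         = a≼b
  anc-trans a≼b (step e b≼c) = step e (anc-trans a≼b b≼c)

  panc⇒anc : ∀ {a b} → PAnc p a b → Anc p a b
  panc⇒anc (step e r) = step e r

  anc∧≢⇒panc : ∀ {a b} → Anc p a b → a ≢ b → PAnc p a b
  anc∧≢⇒panc here       a≢a = contradiction refl a≢a
  anc∧≢⇒panc (step e r) _   = step e r

  parent∧anc⇒panc : ∀ {a c b} → p c ≡ just a → Anc p c b → PAnc p a b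
  parent∧anc⇒panc pc here         = step pc here
  parent∧anc⇒panc pc (step e c≼b) = step e (panc⇒anc (parent∧anc⇒panc pc c≼b))

  panc⇒child∧anc : ∀ {a b} → PAnc p a b → ∃ λ c → p c ≡ just a × Anc p c b
  panc⇒child∧anc {a} (step e a≼u) = below e a≼u
    where
    below : ∀ {b u} → p b ≡ just u → Anc p a u → ∃ λ c → p c ≡ just a × Anc p c b
    below e here           = _ , e , here
    below e (step e' a≼u') with below e' a≼u'
    ... | c , pc , c≼ = c , pc , step e c≼

  ∈-children⇔ : ∀ {u v} → u ∈ children p v ⇔ p u ≡ just v
  ∈-children⇔ {u} {v} = mk⇔ child⇒parent
    (λ e → lookup⇒[]= u _ (trans (lookup∘tabulate isChild u) (dec-true (≡-dec _≟_ (p u) (just v)) e)))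
    where
    isChild : Fin n → Bool
    isChild x = does (≡-dec _≟_ (p x) (just v))
    child⇒parent : u ∈ children p v → p u ≡ just v
    child⇒parent u∈ with ≡-dec _≟_ (p u) (just v) | trans (sym (lookup∘tabulate isChild u)) ([]=⇒lookup u∈)
    ... | yes e | _  = e
    ... | no _  | ()

  siblings-lca : ∀ {a b v} → p a ≡ just v → p b ≡ just v → ¬ Anc p a b → IsLCA p a b v
  siblings-lca {a} {b} {v} pa pb a⋠b = step pa here , step pb here , common
    where
    common : ∀ d → Anc p d a → Anc p d b → Anc p d v
    common d here         d≼b = contradiction d≼b a⋠b
    common d (step e d≼u) _   = subst (Anc p d) (just-injective (trans (sym e) pa)) d≼u

module _ {n : ℕ} {p : Parent n} (acyclic : ∀ u → ¬ PAnc p u u) where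

  panc⇒≢ : ∀ {a b} → PAnc p a b → a ≢ b
  panc⇒≢ {a} a<a refl = acyclic a a<a

  anc-antisym : ∀ {a b} → Anc p a b → Anc p b a → a ≡ b
  anc-antisym here                  _   = refl
  anc-antisym (step {v = b} e a≼u) b≼a = contradiction (step e (anc-trans b≼a a≼u)) (acyclic b)

  lca-unique : ∀ {a b c c'} → IsLCA p a b c → IsLCA p a b c' → c ≡ c'
  lca-unique (c≼a , c≼b , c-greatest) (c'≼a , c'≼b , c'-greatest) =
    anc-antisym (c'-greatest _ c≼a c≼b) (c-greatest _ c'≼a c'≼b)

  siblings-anc⇒≡ : ∀ {a b v} → p a ≡ just v → p b ≡ just v → Anc p a b → a ≡ b
  siblings-anc⇒≡ pa pb here = refl
  siblings-anc⇒≡ {a} pa pb (step e a≼u) =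
    contradiction (step pa (subst (Anc p a) (just-injective (trans (sym e) pb)) a≼u)) (acyclic a)

module _ {n : ℕ} where

  x∈p⇒⁅x⁆⊆p : ∀ {x : Fin n} {p} → x ∈ p → ⁅ x ⁆ ⊆ p
  x∈p⇒⁅x⁆⊆p {x} {p} x∈p y∈⁅x⁆ = subst (_∈ p) (sym (x∈⁅y⁆⇒x≡y x y∈⁅x⁆)) x∈p

  HasTwoElements : Subset n → Set
  HasTwoElements p = ∃₂ λ x y → x ∈ p × y ∈ p × x ≢ y

  HasTwoElements⇒1<∣p∣ : ∀ {p} → HasTwoElements p → 1 < ∣ p ∣
  HasTwoElements⇒1<∣p∣ {p} (x , y , x∈p , y∈p , x≢y) =
    subst (_< ∣ p ∣) (∣⁅x⁆∣≡1 x) (p⊂q⇒∣p∣<∣q∣ (x∈p⇒⁅x⁆⊆p x∈p , y , y∈p , x≢y⇒x∉⁅y⁆ (x≢y ∘ sym)))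

  p≡⊥⊎∣p∣≡1⊎HasTwoElements : ∀ p → p ≡ ⊥ ⊎ ∣ p ∣ ≡ 1 ⊎ HasTwoElements p
  p≡⊥⊎∣p∣≡1⊎HasTwoElements p with nonempty? p
  ... | no empty = inj₁ (Empty-unique empty)
  ... | yes (x , x∈p) with any? (λ y → (y ∈? p) ×-dec ¬? (x ≟ y))
  ...   | yes (y , y∈p , x≢y) = inj₂ (inj₂ (x , y , x∈p , y∈p , x≢y))
  ...   | no noOther = inj₂ (inj₁ (trans (cong ∣_∣ p≡⁅x⁆) (∣⁅x⁆∣≡1 x)))
    where
    p≡⁅x⁆ : p ≡ ⁅ x ⁆
    p≡⁅x⁆ = ⊆-antisym
      (λ {y} y∈p → subst (_∈ ⁅ x ⁆) (decidable-stable (x ≟ y) (λ x≢y → noOther (y , y∈p , x≢y))) (x∈⁅x⁆ x))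
      (x∈p⇒⁅x⁆⊆p x∈p)

  ⊆∧∣≡∣⇒⊇ : ∀ {p q : Subset n} → p ⊆ q → ∣ p ∣ ≡ ∣ q ∣ → q ⊆ p
  ⊆∧∣≡∣⇒⊇ {p} p⊆q ∣p∣≡∣q∣ {x} x∈q =
    decidable-stable (x ∈? p) (λ x∉p → <-irrefl ∣p∣≡∣q∣ (p⊂q⇒∣p∣<∣q∣ (p⊆q , x , x∈q , x∉p)))

  ∉⇒lookup≡false : ∀ {x : Fin n} {p : Subset n} → x ∉ p → lookup p x ≡ false
  ∉⇒lookup≡false {x} {p} x∉p with lookup p x in eq
  ... | true  = contradiction (lookup⇒[]= x p eq) x∉p
  ... | false = refl

  Admissible : Subset n → Subset n → Set
  Admissible C D = C ≡ ⊥ ⊎ ∣ C ∣ ≡ 1 ⊎ ∣ C ∣ ≡ ∣ D ∣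

  ProperSplit : Subset n → Subset n → Set
  ProperSplit C D = HasTwoElements C × ∃ λ x → x ∈ D × x ∉ C

  admissible∧HasTwoElements⇒⊇ : ∀ {C D} → C ⊆ D → Admissible C D → HasTwoElements C → D ⊆ C
  admissible∧HasTwoElements⇒⊇ _   (inj₁ refl)          (_ , _ , x∈⊥ , _) = contradiction x∈⊥ ∉⊥
  admissible∧HasTwoElements⇒⊇ _   (inj₂ (inj₁ ∣C∣≡1))  two = contradiction ∣C∣≡1 (>⇒≢ (HasTwoElements⇒1<∣p∣ two))
  admissible∧HasTwoElements⇒⊇ C⊆D (inj₂ (inj₂ ∣C∣≡∣D∣)) _   = ⊆∧∣≡∣⇒⊇ C⊆D ∣C∣≡∣D∣

  admissible⊎properSplit : ∀ {C D} → C ⊆ D → Admissible C D ⊎ ProperSplit C D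
  admissible⊎properSplit {C} {D} C⊆D with any? (λ x → (x ∈? D) ×-dec ¬? (x ∈? C))
  ... | no noneMissing = inj₁ (inj₂ (inj₂ (cong ∣_∣ (⊆-antisym C⊆D D⊆C))))
    where
    D⊆C : D ⊆ C
    D⊆C {x} x∈D = decidable-stable (x ∈? C) (λ x∉C → noneMissing (x , x∈D , x∉C))
  ... | yes missing with p≡⊥⊎∣p∣≡1⊎HasTwoElements C
  ...   | inj₁ C≡⊥         = inj₁ (inj₁ C≡⊥)
  ...   | inj₂ (inj₁ ∣C∣≡1) = inj₁ (inj₂ (inj₁ ∣C∣≡1))
  ...   | inj₂ (inj₂ two)  = inj₂ (two , missing)

old?-inject₁ : ∀ n (u : Fin n) → old? n (inject₁ u) ≡ just u
old?-inject₁ (suc n) Fin.zero    = refl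
old?-inject₁ (suc n) (Fin.suc u) rewrite old?-inject₁ n u = refl

old?-fromℕ : ∀ n → old? n (fromℕ n) ≡ nothing
old?-fromℕ zero  = refl
old?-fromℕ (suc n) rewrite old?-fromℕ n = refl

data View {n : ℕ} : Fin (suc n) → Set where
  new : View (fromℕ n)
  old : ∀ u → View (inject₁ u)

view : ∀ {n} (x : Fin (suc n)) → View x
view {zero}  Fin.zero    = new
view {suc n} Fin.zero    = old Fin.zero
view {suc n} (Fin.suc x) with view x
... | new   = new
... | old u = old (Fin.suc u)

module Insertion {n : ℕ} (τ : Parent n) (v : Fin n) (C : Subset n) (C⊆children : C ⊆ children τ v) where

  θ : Parent (suc n)
  θ = insertNode τ v C

  ι : Fin n → Fin (suc n)
  ι = inject₁

  w : Fin (suc n)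
  w = fromℕ n

  moved-parent : ∀ {u} → u ∈ C → τ u ≡ just v
  moved-parent = to (∈-children⇔ {p = τ}) ∘ C⊆children

  θ-w : θ w ≡ just (ι v)
  θ-w rewrite old?-fromℕ n = refl

  θ-old : ∀ u → θ (ι u) ≡ (if lookup C u then just w else Maybe.map ι (τ u))
  θ-old u rewrite old?-inject₁ n u = refl

  θ-moved : ∀ {u} → u ∈ C → θ (ι u) ≡ just w
  θ-moved {u} u∈C = trans (θ-old u) (cong (if_then just w else Maybe.map ι (τ u)) ([]=⇒lookup u∈C))

  θ-kept : ∀ {u} → u ∉ C → θ (ι u) ≡ Maybe.map ι (τ u)
  θ-kept {u} u∉C = trans (θ-old u) (cong (if_then just w else Maybe.map ι (τ u)) (∉⇒lookup≡false u∉C))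

  data OldParent (u : Fin n) : Fin (suc n) → Set where
    moved : u ∈ C → OldParent u w
    kept  : ∀ {t} → u ∉ C → τ u ≡ just t → OldParent u (ι t)

  old-parent : ∀ {u y} → θ (ι u) ≡ just y → OldParent u y
  old-parent {u} e with u ∈? C
  ... | yes u∈C with refl ← just-injective (trans (sym (θ-moved u∈C)) e) = moved u∈C
  ... | no u∉C = kept-parent refl (trans (sym (θ-kept u∉C)) e)
    where
    kept-parent : ∀ {m y} → τ u ≡ m → Maybe.map ι m ≡ just y → OldParent u y
    kept-parent {just t} τu≡t refl = kept u∉C τu≡t

  embed-parent : ∀ {b t} → τ b ≡ just t → Anc θ (ι t) (ι b)
  embed-parent {b} τb≡t with b ∈? C
  ... | yes b∈C with refl ← just-injective (trans (sym τb≡t) (moved-parent b∈C)) =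
    step (θ-moved b∈C) (step θ-w here)
  ... | no b∉C = step (trans (θ-kept b∉C) (cong (Maybe.map ι) τb≡t)) here

  embed : ∀ {a b} → Anc τ a b → Anc θ (ι a) (ι b)
  embed here         = here
  embed (step e a≼t) = anc-trans (embed a≼t) (embed-parent e)

  -- The retraction of θ onto τ that contracts the edge from w to v.
  collapse : Fin (suc n) → Fin n
  collapse x = maybe′ id v (old? n x)

  collapse-ι : ∀ u → collapse (ι u) ≡ u
  collapse-ι u rewrite old?-inject₁ n u = refl

  collapse-w : collapse w ≡ v
  collapse-w rewrite old?-fromℕ n = refl

  collapse-parent : ∀ {y y'} → θ y ≡ just y' → Anc τ (collapse y') (collapse y)
  collapse-parent {y} e with view y
  ... | new with refl ← just-injective (trans (sym θ-w) e) rewrite collapse-ι v | collapse-w = here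
  ... | old u with old-parent e
  ...   | moved u∈C rewrite collapse-w | collapse-ι u = step (moved-parent u∈C) here
  ...   | kept {t} _ τu≡t rewrite collapse-ι t | collapse-ι u = step τu≡t here

  collapse-anc : ∀ {x y} → Anc θ x y → Anc τ (collapse x) (collapse y)
  collapse-anc here         = here
  collapse-anc (step e x≼z) = anc-trans (collapse-anc x≼z) (collapse-parent e)

  unembed : ∀ {a b} → Anc θ (ι a) (ι b) → Anc τ a b
  unembed {a} {b} r = subst₂ (Anc τ) (collapse-ι a) (collapse-ι b) (collapse-anc r)

  anc-w⇒anc-v : ∀ {a} → Anc θ (ι a) w → Anc τ a v
  anc-w⇒anc-v {a} r = subst₂ (Anc τ) (collapse-ι a) collapse-w (collapse-anc r)

  unembed-panc : ∀ {a b} → PAnc θ (ι a) (ι b) → PAnc τ a b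
  unembed-panc (step e r) with old-parent e
  ... | moved b∈C   = step (moved-parent b∈C) (anc-w⇒anc-v r)
  ... | kept _ τb≡t = step τb≡t (unembed r)

  embedMap-isMapping : IsMapping τ θ embedMap
  embedMap-isMapping a a' _ _ refl refl = inject₁-injective , mk⇔ embed unembed

  unembed-lca : ∀ {a b c} → IsLCA θ (ι a) (ι b) (ι c) → IsLCA τ a b c
  unembed-lca (c≼a , c≼b , c-greatest) =
    unembed c≼a , unembed c≼b , λ d d≼a d≼b → unembed (c-greatest (ι d) (embed d≼a) (embed d≼b))

  -- The equation y ≡ ι b stands in for the index ι b, which Agda cannot unify with w.
  anc-w⇒∃C : ∀ {y b} → Anc θ w y → y ≡ ι b → ∃ λ c → c ∈ C × Anc τ c b
  anc-w⇒∃C here         w≡ιb = contradiction w≡ιb fromℕ≢inject₁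
  anc-w⇒∃C (step e w≼y) refl with old-parent e
  ... | moved b∈C = _ , b∈C , here
  ... | kept _ τb≡t with anc-w⇒∃C w≼y refl
  ...   | c , c∈C , c≼t = c , c∈C , step τb≡t c≼t

  panc-w⇔∃C : ∀ {b} → PAnc θ w (ι b) ⇔ (∃ λ c → c ∈ C × Anc τ c b)
  panc-w⇔∃C = mk⇔
    (λ w<b → anc-w⇒∃C (panc⇒anc w<b) refl)
    (λ (c , c∈C , c≼b) → anc∧≢⇒panc (anc-trans (step (θ-moved c∈C) here) (embed c≼b)) fromℕ≢inject₁)

  panc-v⇔panc-w : children τ v ⊆ C → ∀ {b} → PAnc τ v b ⇔ PAnc θ w (ι b)
  panc-v⇔panc-w children⊆C = mk⇔
    (λ v<b → let (c , τc≡v , c≼b) = panc⇒child∧anc v<b in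
             from panc-w⇔∃C (c , children⊆C (from (∈-children⇔ {p = τ}) τc≡v) , c≼b))
    (λ w<b → let (c , c∈C , c≼b) = to panc-w⇔∃C w<b in parent∧anc⇒panc (moved-parent c∈C) c≼b)

  module _ (acyclic : ∀ u → ¬ PAnc τ u u) where

    embed-panc⇔ : ∀ {a b} → PAnc τ a b ⇔ PAnc θ (ι a) (ι b)
    embed-panc⇔ = mk⇔
      (λ a<b → anc∧≢⇒panc (embed (panc⇒anc a<b)) (panc⇒≢ acyclic a<b ∘ inject₁-injective))
      unembed-panc

    lca-w⇒ : ∀ {a b c} → IsLCA τ a b c → IsLCA θ (ι a) (ι b) w → c ≡ v × HasTwoElements C
    lca-w⇒ {c = c} (c≼a , c≼b , c-greatest) (w≼a , w≼b , w-greatest)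
      with anc-w⇒∃C w≼a refl | anc-w⇒∃C w≼b refl
    ... | c₁ , c₁∈C , c₁≼a | c₂ , c₂∈C , c₂≼b = c≡v , c₁ , c₂ , c₁∈C , c₂∈C , c₁≢c₂
      where
      below-C⇒below-v : ∀ {c' x} → c' ∈ C → Anc τ c' x → Anc τ v x
      below-C⇒below-v c'∈C = anc-trans (step (moved-parent c'∈C) here)
      c≡v : c ≡ v
      c≡v = anc-antisym acyclic (anc-w⇒anc-v (w-greatest (ι c) (embed c≼a) (embed c≼b)))
                                (c-greatest v (below-C⇒below-v c₁∈C c₁≼a) (below-C⇒below-v c₂∈C c₂≼b))
      c₁≢c₂ : c₁ ≢ c₂
      c₁≢c₂ refl = acyclic c₁ (step (moved-parent c₁∈C) (subst (Anc τ c₁) c≡v (c-greatest c₁ c₁≼a c₂≼b)))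

    lca-preserves-panc : Admissible C (children τ v) → ∀ {a b c c' x} →
      IsLCA τ a b c → IsLCA θ (ι a) (ι b) c' → PAnc τ c x ⇔ PAnc θ c' (ι x)
    lca-preserves-panc admissible {c' = c'} L L' with view c'
    ... | old c'' with refl ← lca-unique acyclic L (unembed-lca L') = embed-panc⇔
    ... | new with lca-w⇒ L L'
    ...   | refl , two = panc-v⇔panc-w (admissible∧HasTwoElements⇒⊇ C⊆children admissible two)

    admissible⇒constrained : Admissible C (children τ v) → IsConstrainedMapping τ θ embedMap
    admissible⇒constrained admissible =
      embedMap-isMapping , λ { _ _ _ _ _ _ refl refl refl _ _ L L' → lca-preserves-panc admissible L L' }

    constrained⇒admissible : IsConstrainedMapping τ θ embedMap → Admissible C (children τ v)
    constrained⇒admissible (_ , constrained) with admissible⊎properSplit C⊆children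
    ... | inj₁ admissible = admissible
    ... | inj₂ ((c₁ , c₂ , c₁∈C , c₂∈C , c₁≢c₂) , c₃ , c₃∈children , c₃∉C) =
      contradiction (to panc-w⇔∃C w<c₃) c₃-not-below-C
      where
      τc₃≡v : τ c₃ ≡ just v
      τc₃≡v = to (∈-children⇔ {p = τ}) c₃∈children
      c₁⋠c₂ : ¬ Anc τ c₁ c₂
      c₁⋠c₂ = c₁≢c₂ ∘ siblings-anc⇒≡ acyclic (moved-parent c₁∈C) (moved-parent c₂∈C)
      -- The violating triple: LCA(c₁, c₂) is v in τ, a proper ancestor of c₃, and w in θ.
      w<c₃ : PAnc θ w (ι c₃)
      w<c₃ = to (constrained c₁ c₂ c₃ _ _ _ refl refl refl v w
                   (siblings-lca (moved-parent c₁∈C) (moved-parent c₂∈C) c₁⋠c₂)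
                   (siblings-lca (θ-moved c₁∈C) (θ-moved c₂∈C) (c₁⋠c₂ ∘ unembed)))
                (step τc₃≡v here)
      c₃-not-below-C : ¬ ∃ λ c → c ∈ C × Anc τ c c₃
      c₃-not-below-C (c , c∈C , c≼c₃) =
        c₃∉C (subst (_∈ C) (siblings-anc⇒≡ acyclic (moved-parent c∈C) τc₃≡v c≼c₃) c∈C)

lemma2 : ∀ {n : ℕ} (τ : Parent n) → IsRootedTree τ → (v : Fin n) → (C : Subset n) →
    C ⊆ children τ v →
    (IsConstrainedMapping τ (insertNode τ v C) embedMap ⇔
      (C ≡ ⊥ ⊎ ∣ C ∣ ≡ 1 ⊎ ∣ C ∣ ≡ ∣ children τ v ∣))
lemma2 τ tree v C C⊆children = mk⇔ (constrained⇒admissible acyclic) (admissible⇒constrained acyclic)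
  where
  open Insertion τ v C C⊆children
  acyclic : ∀ u → ¬ PAnc τ u u
  acyclic = IsRootedTree.acyclic tree
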